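{- Let $A$ and $B$ be $0,1$-matrices, and let $M$ be a $0,1$-matrix of Boolean rank $1$ such that $M\preceq A\otimes B$. Then there exist $0,1$-matrices $M_A$ and $M_B$ of Boolean rank $1$ satisfying $M_A\preceq A$, $M_B\preceq B$, and $M\preceq M_A\otimes M_B$.
   Context: For $0,1$-matrices $M,A$ of the same size, $M\preceq A$ means $M_{i,j}\le A_{i,j}$ for all $i,j$. The Boolean rank of a $0,1$-matrix is the smallest number of all-ones combinatorial rectangles (sets $X\times Y$ of rows times columns on which the matrix is all $1$) needed to cover its $1$-entries; a matrix has Boolean rank $1$ iff it is nonzero and its $1$-entries form a combinatorial rectangle. The Kronecker product $A\otimes B$ is the block matrix whose $(i,j)$-th block is $A_{i,j}\cdot B$. -}

module Defs where

open import Data.Nat using (ℕ; _*_)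
open import Data.Fin using (Fin; remQuot)
open import Data.Bool using (Bool; true; false; _∧_; T)
open import Data.Product using (Σ; ∃-syntax; _×_; _,_)
open import Function.Bundles using (_⇔_)
open import Relation.Binary.PropositionalEquality using (_≡_)

Matrix : ℕ → ℕ → Set
Matrix m n = Fin m → Fin n → Bool

_≼_ : ∀ {m n} → Matrix m n → Matrix m n → Set
M ≼ A = ∀ i j → M i j ≡ true → A i j ≡ true

-- Kronecker product: rows of A ⊗ B indexed by Fin (m * p), where the
-- row i * p + k (i : Fin m, k : Fin p) lies in block row i, inner row k;
-- (A ⊗ B) at ((i,k),(j,l)) = A i j · B k l
_⊗_ : ∀ {m n p q} → Matrix m n → Matrix p q → Matrix (m * p) (n * q)
_⊗_ {m} {n} {p} {q} A B r c with remQuot {m} p r | remQuot {n} q c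
... | i , k | j , l = A i j ∧ B k l

-- Boolean rank 1: M is nonzero and its 1-entries form a combinatorial
-- rectangle X × Y (X a set of rows, Y a set of columns)
BoolRank1 : ∀ {m n} → Matrix m n → Set
BoolRank1 {m} {n} M =
  (∃[ i ] ∃[ j ] M i j ≡ true) ×
  (Σ (Fin m → Bool) λ X → Σ (Fin n → Bool) λ Y →
      ∀ i j → (M i j ≡ true) ⇔ (T (X i) × T (Y j)))

-- If the 1-entries of M form the rectangle X × Y, project X onto block-row
-- and inner-row indices and Y onto block-column and inner-column indices.
-- The block projections span M_A, the inner ones span M_B; M ≼ M_A ⊗ M_B
-- because each 1-entry of M projects into both rectangles, and M_A ≼ A
-- because a 1-entry (i, j) of M_A lifts to a 1-entry of M, which lies in
-- the block A i j · B.
module Submission where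

open import Defs
open import Data.Nat using (ℕ; _*_)
open import Data.Fin using (Fin; quotient; remainder; _≟_)
open import Data.Fin.Properties using (any?)
open import Data.Bool using (Bool; true; _∧_; T; T?)
open import Data.Bool.Properties using (T-≡; T-∧; ∧-conicalˡ; ∧-conicalʳ)
open import Data.Product using (Σ; ∃-syntax; _×_; _,_; proj₁; proj₂)
open import Function using (_∘′_)
open import Function.Bundles using (_⇔_; mk⇔; Equivalence)
open import Function.Properties.Equivalence using (sym; trans)
open import Relation.Nullary.Decidable using (⌊_⌋; _×-dec_; toWitness; fromWitness)
open import Relation.Binary.PropositionalEquality using (_≡_; refl; cong₂; subst₂)

private
  variable
    a b m n p q : ℕ

image : (Fin a → Fin b) → (Fin a → Bool) → Fin b → Bool
image f X y = ⌊ any? (λ x → T? (X x) ×-dec f x ≟ y) ⌋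

image-intro : ∀ (f : Fin a → Fin b) X x → T (X x) → T (image f X (f x))
image-intro f X x x∈X = fromWitness (x , x∈X , refl)

image-elim : ∀ (f : Fin a → Fin b) X y → T (image f X y) → ∃[ x ] T (X x) × f x ≡ y
image-elim f X y = toWitness

rectangle : (Fin m → Bool) → (Fin n → Bool) → Matrix m n
rectangle X Y i j = X i ∧ Y j

rectangle-≡true : ∀ (X : Fin m → Bool) (Y : Fin n → Bool) i j →
  (rectangle X Y i j ≡ true) ⇔ (T (X i) × T (Y j))
rectangle-≡true X Y i j = trans (sym T-≡) T-∧

rectangle-boolRank1 : ∀ (X : Fin m → Bool) (Y : Fin n → Bool) {i j} →
  T (X i) → T (Y j) → BoolRank1 (rectangle X Y)
rectangle-boolRank1 X Y {i} {j} i∈X j∈Y =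
  (i , j , Equivalence.from (rectangle-≡true X Y i j) (i∈X , j∈Y)) , X , Y , rectangle-≡true X Y

≼-trans : {L M N : Matrix m n} → L ≼ M → M ≼ N → L ≼ N
≼-trans L≼M M≼N i j = M≼N i j ∘′ L≼M i j

rectangle-≼ : ∀ (X : Fin m → Bool) (Y : Fin n → Bool) {C : Matrix m n} →
  (∀ i j → T (X i) → T (Y j) → C i j ≡ true) → rectangle X Y ≼ C
rectangle-≼ X Y X×Y⊆C i j e =
  let i∈X , j∈Y = Equivalence.to (rectangle-≡true X Y i j) e in X×Y⊆C i j i∈X j∈Y

image-rectangle-≼ : ∀ {m′ n′} (f : Fin m → Fin m′) (g : Fin n → Fin n′)
  {X : Fin m → Bool} {Y : Fin n → Bool} {C : Matrix m′ n′} →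
  (∀ i j → T (X i) → T (Y j) → C (f i) (g j) ≡ true) →
  rectangle (image f X) (image g Y) ≼ C
image-rectangle-≼ f g {X} {Y} {C} X×Y⊆C =
  rectangle-≼ (image f X) (image g Y) λ i′ j′ i′∈fX j′∈gY →
    let i , i∈X , fi≡i′ = image-elim f X i′ i′∈fX
        j , j∈Y , gj≡j′ = image-elim g Y j′ j′∈gY
    in subst₂ (λ i′ j′ → C i′ j′ ≡ true) fi≡i′ gj≡j′ (X×Y⊆C i j i∈X j∈Y)

⊗-≡true : ∀ (A : Matrix m n) (B : Matrix p q) r c →
  ((A ⊗ B) r c ≡ true) ⇔
  (A (quotient p r) (quotient q c) ≡ true × B (remainder {m} p r) (remainder {n} q c) ≡ true)
⊗-≡true A B r c = mk⇔ (λ e → ∧-conicalˡ _ _ e , ∧-conicalʳ _ _ e) (λ (eA , eB) → cong₂ _∧_ eA eB)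

module KroneckerProjections {m n p q : ℕ} (X : Fin (m * p) → Bool) (Y : Fin (n * q) → Bool) where

  blockRows : Fin m → Bool
  blockRows = image (quotient {m} p) X

  blockCols : Fin n → Bool
  blockCols = image (quotient {n} q) Y

  innerRows : Fin p → Bool
  innerRows = image (remainder {m} p) X

  innerCols : Fin q → Bool
  innerCols = image (remainder {n} q) Y

  blockRectangle : Matrix m n
  blockRectangle = rectangle blockRows blockCols

  innerRectangle : Matrix p q
  innerRectangle = rectangle innerRows innerCols

  module _ {r c} (r∈X : T (X r)) (c∈Y : T (Y c)) where

    blockRectangle-boolRank1 : BoolRank1 blockRectangle
    blockRectangle-boolRank1 = rectangle-boolRank1 blockRows blockCols
      (image-intro (quotient {m} p) X r r∈X) (image-intro (quotient {n} q) Y c c∈Y)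

    innerRectangle-boolRank1 : BoolRank1 innerRectangle
    innerRectangle-boolRank1 = rectangle-boolRank1 innerRows innerCols
      (image-intro (remainder {m} p) X r r∈X) (image-intro (remainder {n} q) Y c c∈Y)

  rectangle-≼-block⊗inner : rectangle X Y ≼ (blockRectangle ⊗ innerRectangle)
  rectangle-≼-block⊗inner = rectangle-≼ X Y λ r c r∈X c∈Y →
    Equivalence.from (⊗-≡true blockRectangle innerRectangle r c)
      ( Equivalence.from (rectangle-≡true blockRows blockCols _ _)
          (image-intro (quotient {m} p) X r r∈X , image-intro (quotient {n} q) Y c c∈Y)
      , Equivalence.from (rectangle-≡true innerRows innerCols _ _)
          (image-intro (remainder {m} p) X r r∈X , image-intro (remainder {n} q) Y c c∈Y) )

  module _ {A : Matrix m n} {B : Matrix p q} (X×Y≼A⊗B : rectangle X Y ≼ (A ⊗ B)) where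

    private
      A⊗B-on-X×Y : ∀ r c → T (X r) → T (Y c) → (A ⊗ B) r c ≡ true
      A⊗B-on-X×Y r c r∈X c∈Y =
        X×Y≼A⊗B r c (Equivalence.from (rectangle-≡true X Y r c) (r∈X , c∈Y))

    blockRectangle-≼ : blockRectangle ≼ A
    blockRectangle-≼ = image-rectangle-≼ (quotient {m} p) (quotient {n} q) λ r c r∈X c∈Y →
      proj₁ (Equivalence.to (⊗-≡true A B r c) (A⊗B-on-X×Y r c r∈X c∈Y))

    innerRectangle-≼ : innerRectangle ≼ B
    innerRectangle-≼ = image-rectangle-≼ (remainder {m} p) (remainder {n} q) λ r c r∈X c∈Y →
      proj₂ (Equivalence.to (⊗-≡true A B r c) (A⊗B-on-X×Y r c r∈X c∈Y))

claim1 : ∀ {m n p q} (A : Matrix m n) (B : Matrix p q) (M : Matrix (m * p) (n * q)) →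
    BoolRank1 M → M ≼ (A ⊗ B) →
    Σ (Matrix m n) λ MA → Σ (Matrix p q) λ MB →
      BoolRank1 MA × BoolRank1 MB × MA ≼ A × MB ≼ B × M ≼ (MA ⊗ MB)
claim1 {m} {n} {p} {q} A B M ((r₀ , c₀ , M₀) , X , Y , M⇔X×Y) M≼A⊗B =
  blockRectangle , innerRectangle ,
  blockRectangle-boolRank1 r₀∈X c₀∈Y , innerRectangle-boolRank1 r₀∈X c₀∈Y ,
  blockRectangle-≼ {A} {B} X×Y≼A⊗B , innerRectangle-≼ {A} {B} X×Y≼A⊗B ,
  ≼-trans M≼X×Y rectangle-≼-block⊗inner
  where
  open KroneckerProjections {m} {n} {p} {q} X Y

  M≼X×Y : M ≼ rectangle X Y
  M≼X×Y r c = Equivalence.from (rectangle-≡true X Y r c) ∘′ Equivalence.to (M⇔X×Y r c)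

  X×Y≼A⊗B : rectangle X Y ≼ (A ⊗ B)
  X×Y≼A⊗B = ≼-trans (rectangle-≼ X Y λ r c r∈X c∈Y → Equivalence.from (M⇔X×Y r c) (r∈X , c∈Y))
                    M≼A⊗B

  r₀∈X : T (X r₀)
  r₀∈X = proj₁ (Equivalence.to (M⇔X×Y r₀ c₀) M₀)

  c₀∈Y : T (Y c₀)
  c₀∈Y = proj₂ (Equivalence.to (M⇔X×Y r₀ c₀) M₀)
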